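{- Let $s_2$ be a binary string with $|s_2|\ge3$, $s_2\ne001$, and $S=\{001,s_2\}$. The Seeker wins the Renyi-Ulam game with lie restriction $r(S)$ if and only if $s_2\in R_\#$.
   Context: $R_\#$ is the set of binary strings containing no substring $01^k0$ with $k=0$ or $k\ge2$ ($1^k$ denotes $k$ consecutive $1$s); explicitly $R_\#=\{1^a w 1^c: a,c\ge0,\ w \text{ empty or } w=(01)^j0,\ j\ge0\}$. For a set $S$ of nonempty binary strings, $r(S)$ is the set of finite binary strings containing no element of $S$ as a contiguous substring. Renyi-Ulam game with lie restriction $R$: the Obscurer picks $x\in\{1,\dots,n\}$; each turn the Seeker asks whether $x$ lies in a chosen subset and the Obscurer answers yes or no. The lie pattern of a candidate $y$ is the binary string whose $i$-th bit is $1$ iff the $i$-th answer is false for $y$; the Obscurer's answers must keep her number's lie pattern in $R$. The Seeker wins for $n$ if he has an adaptive strategy guaranteeing after finitely many questions that at most one $y\in\{1,\dots,n\}$ has lie pattern in $R$; "the Seeker wins" means he wins for every $n\ge1$. -}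

module Defs where

open import Data.Bool using (Bool; true; false; _xor_)
open import Data.List using (List; []; _∷_; _++_; [_]; replicate)
open import Data.Nat using (ℕ; _≤_)
open import Data.Fin using (Fin)
open import Data.Product using (∃₂; _×_)
open import Data.Sum using (_⊎_)
open import Relation.Nullary using (¬_)
open import Relation.Binary.PropositionalEquality using (_≡_)

-- Bits: 1 = true, 0 = false.  A binary string is a List Bool.

_⊑_ : List Bool → List Bool → Set
u ⊑ w = ∃₂ λ pre suf → w ≡ pre ++ u ++ suf

LieRestriction : Set₁
LieRestriction = List Bool → Set

r₂ : List Bool → List Bool → LieRestriction
r₂ s₁ s₂ w = ¬ (s₁ ⊑ w) × ¬ (s₂ ⊑ w)

s001 : List Bool
s001 = false ∷ false ∷ true ∷ []

R♯ : LieRestriction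
R♯ w = ∀ (k : ℕ) → (k ≡ 0 ⊎ 2 ≤ k) →
       ¬ ((false ∷ replicate k true ++ [ false ]) ⊑ w)

-- Game state: the lie pattern (so far) of every candidate y ∈ {1..n}.
State : ℕ → Set
State n = Fin n → List Bool

-- Seeker asks "is x ∈ Q?" (Q as characteristic function), answer b (true = yes).
-- Candidate y's new lie bit is 1 iff the answer is false for y, i.e. b ≠ Q y.
update : ∀ {n} → State n → (Fin n → Bool) → Bool → State n
update st Q b y = st y ++ [ b xor Q y ]

AtMostOneValid : ∀ {n} → LieRestriction → State n → Set
AtMostOneValid R st = ∀ y z → R (st y) → R (st z) → y ≡ z

-- Seeker has an adaptive strategy that, from state st, guarantees after finitely
-- many questions that at most one candidate is valid, whatever the answers.
-- (An answer that leaves no candidate valid is illegal for the Obscurer; the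
-- resulting state trivially satisfies AtMostOneValid, so quantifying over both
-- answers is harmless.)
data SeekerWinsFrom (R : LieRestriction) {n : ℕ} (st : State n) : Set where
  done : AtMostOneValid R st → SeekerWinsFrom R st
  ask  : (Q : Fin n → Bool) →
         ((b : Bool) → SeekerWinsFrom R (update st Q b)) →
         SeekerWinsFrom R st

SeekerWinsFor : LieRestriction → ℕ → Set
SeekerWinsFor R n = SeekerWinsFrom R {n} (λ _ → [])

SeekerWins : LieRestriction → Set
SeekerWins R = ∀ (n : ℕ) → 1 ≤ n → SeekerWinsFor R n

-- For s₂ ∈ R♯, i.e. s₂ = 1^m or s₂ = 1^a 0 (10)^j 1^c, the Seeker eliminates the candidates in
-- pairs, elimination being permanent.  For a pair he drives the lie pattern of one candidate
-- along s₂; the shape of s₂ ensures that every answer deviating from it leaves one of the two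
-- patterns ending in 00, and such a pattern is killed (by 001) at its next lie, so the Seeker can
-- then steer the other pattern through all of s₂.
-- Conversely, if s₂ contains 01^k0 with k = 0 or k ≥ 2, the Obscurer defeats already two candidates
-- by keeping both patterns free of 00 and 01^k0, hence of 001 and s₂: a question not separating
-- them is answered so that both lie, and for a separating one the truthful bit 0 goes to a
-- candidate whose pattern does not end in 0 or 01^k, chosen so that the trailing run of 1s of the
-- other one does not reach k; as k ≠ 1, such a choice always exists.

module Submission where

open import Data.Bool using (Bool; true; false; not; _xor_)
open import Data.Empty using (⊥-elim)
open import Data.Fin as Fin using (Fin)
open import Data.List using (List; []; _∷_; _++_; [_]; replicate; concat; length; allFin; cartesianProduct)
open import Data.List.Base using (initLast; _∷ʳ′_)
open import Data.List.Membership.Propositional.Properties using (∈-allFin; ∈-cartesianProduct⁺)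
open import Data.List.Properties using (++-assoc; ++-identityʳ; ∷ʳ-injective; ∷-injectiveʳ)
open import Data.List.Relation.Unary.All as All using (All; []; _∷_)
open import Data.Nat using (ℕ; zero; suc; _≤_; _≟_; s≤s; z≤n)
open import Data.Nat.Properties using (suc-injective; 1+n≢n)
open import Data.Product using (∃; ∃₂; Σ; _×_; _,_; proj₁; proj₂)
open import Data.Sum using (_⊎_; inj₁; inj₂)
open import Data.Unit using (⊤; tt)
open import Function.Bundles using (_⇔_; mk⇔)
open import Relation.Nullary using (¬_; Dec; yes; no; _⊎-dec_)
open import Relation.Nullary.Decidable using (isYes)
open import Relation.Binary.PropositionalEquality
  using (_≡_; _≢_; refl; sym; trans; cong; subst; module ≡-Reasoning)

open import Defs

_EndsWith_ : List Bool → List Bool → Set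
x EndsWith v = ∃ λ p → x ≡ p ++ v

endsWith-[] : ∀ x → x EndsWith []
endsWith-[] x = x , sym (++-identityʳ x)

endsWith-∷ʳ : ∀ {x v} c → x EndsWith v → (x ++ [ c ]) EndsWith (v ++ [ c ])
endsWith-∷ʳ {v = v} c (p , refl) = p , ++-assoc p v [ c ]

endsWith-++⁻ : ∀ {x} u {v} → x EndsWith (u ++ v) → x EndsWith v
endsWith-++⁻ u {v} (p , refl) = p ++ u , sym (++-assoc p u v)

endsWith-∷ʳ⁻ : ∀ {x v c d} → (x ++ [ c ]) EndsWith (v ++ [ d ]) → c ≡ d × x EndsWith v
endsWith-∷ʳ⁻ {x} {v} {d = d} (p , eq)
  with x≡pv , c≡d ← ∷ʳ-injective x (p ++ v) (trans eq (sym (++-assoc p v [ d ])))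
  = c≡d , p , x≡pv

endsWith-∷ʳ-split : ∀ {y v d} → y EndsWith (v ++ [ d ]) → ∃ λ x → y ≡ x ++ [ d ] × x EndsWith v
endsWith-∷ʳ-split {v = v} {d} (p , refl) = p ++ v , sym (++-assoc p v [ d ]) , p , refl

endsWith⇒⊑ : ∀ {x v} → x EndsWith v → v ⊑ x
endsWith⇒⊑ {v = v} (p , refl) = p , [] , cong (p ++_) (sym (++-identityʳ v))

⊑-trans : ∀ {u v w} → u ⊑ v → v ⊑ w → u ⊑ w
⊑-trans {u} (p₁ , s₁ , refl) (p₂ , s₂ , refl) = p₂ ++ p₁ , s₁ ++ s₂ , (begin
  p₂ ++ (p₁ ++ u ++ s₁) ++ s₂   ≡⟨ cong (p₂ ++_) (++-assoc p₁ (u ++ s₁) s₂) ⟩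
  p₂ ++ p₁ ++ (u ++ s₁) ++ s₂   ≡⟨ cong (λ t → p₂ ++ p₁ ++ t) (++-assoc u s₁ s₂) ⟩
  p₂ ++ p₁ ++ u ++ s₁ ++ s₂     ≡⟨ sym (++-assoc p₂ p₁ (u ++ s₁ ++ s₂)) ⟩
  (p₂ ++ p₁) ++ u ++ s₁ ++ s₂   ∎)
  where open ≡-Reasoning

⊑-∷ : ∀ {u w} x → u ⊑ w → u ⊑ (x ∷ w)
⊑-∷ x (p , s , eq) = x ∷ p , s , cong (x ∷_) eq

⊑-∷ʳ : ∀ {u w} c → u ⊑ w → u ⊑ (w ++ [ c ])
⊑-∷ʳ {u} c (p , s , refl) = p , s ++ [ c ] ,
  trans (++-assoc p (u ++ s) [ c ]) (cong (p ++_) (++-assoc u s [ c ]))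

⊑-∷ʳ⁻ : ∀ {u} w c → u ⊑ (w ++ [ c ]) → u ⊑ w ⊎ (w ++ [ c ]) EndsWith u
⊑-∷ʳ⁻ {u} w c (p , s , eq) with initLast s
... | [] = inj₂ (p , trans eq (cong (p ++_) (++-identityʳ u)))
... | s′ ∷ʳ′ d = inj₁ (p , s′ , proj₁ (∷ʳ-injective w (p ++ u ++ s′) (begin
  w ++ [ c ]              ≡⟨ eq ⟩
  p ++ u ++ s′ ++ [ d ]   ≡⟨ cong (p ++_) (sym (++-assoc u s′ [ d ])) ⟩
  p ++ (u ++ s′) ++ [ d ] ≡⟨ sym (++-assoc p (u ++ s′) [ d ]) ⟩
  (p ++ u ++ s′) ++ [ d ] ∎)))
  where open ≡-Reasoning

¬∷⊑[] : ∀ {x u} → ¬ (x ∷ u) ⊑ []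
¬∷⊑[] ([] , _ , ())
¬∷⊑[] (_ ∷ _ , _ , ())

replicate-∷ʳ : ∀ {A : Set} n (x : A) → replicate (suc n) x ≡ replicate n x ++ [ x ]
replicate-∷ʳ zero    x = refl
replicate-∷ʳ (suc n) x = cong (x ∷_) (replicate-∷ʳ n x)

replicate-++-∷ : ∀ {A : Set} n (x : A) xs → replicate n x ++ x ∷ xs ≡ replicate (suc n) x ++ xs
replicate-++-∷ zero    x xs = refl
replicate-++-∷ (suc n) x xs = cong (x ∷_) (replicate-++-∷ n x xs)

run : ℕ → List Bool
run i = false ∷ replicate i true

endsWith-run-suc : ∀ {x} i → x EndsWith run (suc i) → x EndsWith (run i ++ [ true ])
endsWith-run-suc {x} i = subst (x EndsWith_) (cong (false ∷_) (replicate-∷ʳ i true))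

endsWith-run-∷ʳ : ∀ {x} i → x EndsWith run i → (x ++ [ true ]) EndsWith run (suc i)
endsWith-run-∷ʳ {x} i x-i =
  subst ((x ++ [ true ]) EndsWith_) (cong (false ∷_) (sym (replicate-∷ʳ i true))) (endsWith-∷ʳ true x-i)

endsWith-run-∷ʳ⁻ : ∀ {x c} j → (x ++ [ c ]) EndsWith run (suc j) → c ≡ true × x EndsWith run j
endsWith-run-∷ʳ⁻ j x-j = endsWith-∷ʳ⁻ {v = run j} (endsWith-run-suc j x-j)

endsWith-run-unique : ∀ {x} i j → x EndsWith run i → x EndsWith run j → i ≡ j
endsWith-run-unique zero    zero    _          _          = refl
endsWith-run-unique zero    (suc j) (p , refl) x-j        with () ← proj₁ (endsWith-run-∷ʳ⁻ j x-j)
endsWith-run-unique (suc i) zero    x-i        (p , refl) with () ← proj₁ (endsWith-run-∷ʳ⁻ i x-i)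
endsWith-run-unique (suc i) (suc j) x-i        x-j
  with x′ , refl , x′-i ← endsWith-∷ʳ-split {v = run i} {true} (endsWith-run-suc i x-i)
  = cong suc (endsWith-run-unique i j x′-i (proj₂ (endsWith-run-∷ʳ⁻ j x-j)))

ones-∌-run : ∀ m {j} → ¬ replicate m true EndsWith run j
ones-∌-run zero    ([] , ())
ones-∌-run zero    (_ ∷ _ , ())
ones-∌-run (suc m) ([] , ())
ones-∌-run (suc m) (_ ∷ p , eq) = ones-∌-run m (p , ∷-injectiveʳ eq)

xor-false : ∀ b {q} → q ≡ false → b xor q ≡ b
xor-false true  refl = refl
xor-false false refl = refl

xor-true : ∀ b {q} → q ≡ true → b xor q ≡ not b
xor-true true  refl = refl
xor-true false refl = refl

lieBit : ∀ {p : List Bool} {c d} → c ≡ d → p ++ [ c ] ≡ p ++ [ d ]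
lieBit {p} = cong (λ c → p ++ [ c ])

data Forces {n} (P : State n → Set) : State n → Set where
  reached : ∀ {st} → P st → Forces P st
  query   : ∀ {st} (Q : Fin n → Bool) → ((b : Bool) → Forces P (update st Q b)) → Forces P st

Persistent : ∀ {n} → (State n → Set) → Set
Persistent P = ∀ {s} Q b → P s → P (update s Q b)

module _ {n : ℕ} where

  forces-map : ∀ {P P′ : State n → Set} {st} → (∀ {s} → P s → P′ s) → Forces P st → Forces P′ st
  forces-map f (reached p) = reached (f p)
  forces-map f (query Q g) = query Q λ b → forces-map f (g b)

  forces-bind : ∀ {P P′ : State n → Set} {st} → Forces P st → (∀ {s} → P s → Forces P′ s) →
                Forces P′ st
  forces-bind (reached p) f = f p
  forces-bind (query Q g) f = query Q λ b → forces-bind (g b) f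

  forces-keep : ∀ {I P : State n → Set} {st} → Persistent I → I st → Forces P st →
                Forces (λ s → I s × P s) st
  forces-keep I-pers i (reached p) = reached (i , p)
  forces-keep I-pers i (query Q g) = query Q λ b → forces-keep I-pers (I-pers Q b i) (g b)

  forces-all : ∀ {A : Set} {P : A → State n → Set} → (∀ a → Persistent (P a)) →
               (∀ a st → Forces (P a) st) → ∀ as st → Forces (λ s → All (λ a → P a s) as) st
  forces-all P-pers forces-P []       st = reached []
  forces-all P-pers forces-P (a ∷ as) st = forces-bind (forces-all P-pers forces-P as st) λ {s} all-as →
    forces-map (λ (all-as′ , pa) → pa ∷ all-as′)
      (forces-keep (λ Q b → All.map (P-pers _ Q b)) all-as (forces-P a s))

  forces⇒seekerWinsFrom : ∀ {R} {st : State n} → Forces (AtMostOneValid R) st → SeekerWinsFrom R st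
  forces⇒seekerWinsFrom (reached p) = done p
  forces⇒seekerWinsFrom (query Q g) = ask Q λ b → forces⇒seekerWinsFrom (g b)

  isCandidate : Fin n → Fin n → Bool
  isCandidate z v = isYes (v Fin.≟ z)

  isCandidate-self : ∀ z → isCandidate z z ≡ true
  isCandidate-self z with z Fin.≟ z
  ... | yes _   = refl
  ... | no z≢z = ⊥-elim (z≢z refl)

  isCandidate-other : ∀ {y z} → y ≢ z → isCandidate z y ≡ false
  isCandidate-other {y} {z} y≢z with y Fin.≟ z
  ... | yes y≡z = ⊥-elim (y≢z y≡z)
  ... | no _    = refl

module PairwiseElimination (R : LieRestriction) (R-∷ʳ⁻ : ∀ {p} c → R (p ++ [ c ]) → R p) where

  -- The game restricted to two candidates with lie patterns x and y: a question gives them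
  -- either the same lie bit or opposite ones.
  data PairWin (x y : List Bool) : Set where
    won      : ¬ R x ⊎ ¬ R y → PairWin x y
    askSame  : ((b : Bool) → PairWin (x ++ [ b ]) (y ++ [ b ])) → PairWin x y
    askSplit : ((b : Bool) → PairWin (x ++ [ b ]) (y ++ [ not b ])) → PairWin x y

  pairWin-sym : ∀ {x y} → PairWin x y → PairWin y x
  pairWin-sym (won (inj₁ x∉R)) = won (inj₂ x∉R)
  pairWin-sym (won (inj₂ y∉R)) = won (inj₁ y∉R)
  pairWin-sym (askSame f)      = askSame λ b → pairWin-sym (f b)
  pairWin-sym (askSplit f)     = askSplit λ { true → pairWin-sym (f false) ; false → pairWin-sym (f true) }

  module _ {n : ℕ} where

    Decided : Fin n → Fin n → State n → Set
    Decided y z s = ¬ R (s y) ⊎ ¬ R (s z)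

    pairWin⇒forces : ∀ {y z} → y ≢ z → ∀ {x w} → PairWin x w →
                     ∀ st → st y ≡ x → st z ≡ w → Forces (Decided y z) st
    pairWin⇒forces y≢z (won d)      st refl refl = reached d
    pairWin⇒forces y≢z (askSame f)  st refl refl = query (λ _ → false) λ b →
      pairWin⇒forces y≢z (f b) _ (lieBit (xor-false b refl)) (lieBit (xor-false b refl))
    pairWin⇒forces {y} {z} y≢z (askSplit f) st refl refl = query (isCandidate z) λ b →
      pairWin⇒forces y≢z (f b) _ (lieBit (xor-false b (isCandidate-other y≢z)))
                                 (lieBit (xor-true b (isCandidate-self z)))

    Settled : State n → Fin n × Fin n → Set
    Settled s (y , z) = y ≡ z ⊎ Decided y z s

    settled-persistent : ∀ yz → Persistent (λ s → Settled s yz)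
    settled-persistent _ Q b (inj₁ y≡z)         = inj₁ y≡z
    settled-persistent _ Q b (inj₂ (inj₁ y∉R)) = inj₂ (inj₁ λ r → y∉R (R-∷ʳ⁻ _ r))
    settled-persistent _ Q b (inj₂ (inj₂ z∉R)) = inj₂ (inj₂ λ r → z∉R (R-∷ʳ⁻ _ r))

    forces-settled : (∀ x w → PairWin x w) → ∀ yz st → Forces (λ s → Settled s yz) st
    forces-settled win (y , z) st with y Fin.≟ z
    ... | yes y≡z = reached (inj₁ y≡z)
    ... | no y≢z  = forces-map inj₂ (pairWin⇒forces y≢z (win (st y) (st z)) st refl refl)

    allSettled⇒atMostOneValid : ∀ {s} → All (Settled s) (cartesianProduct (allFin n) (allFin n)) →
                                AtMostOneValid R s
    allSettled⇒atMostOneValid settled y z y∈R z∈R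
      with All.lookup settled (∈-cartesianProduct⁺ (∈-allFin y) (∈-allFin z))
    ... | inj₁ y≡z         = y≡z
    ... | inj₂ (inj₁ y∉R) = ⊥-elim (y∉R y∈R)
    ... | inj₂ (inj₂ z∉R) = ⊥-elim (z∉R z∈R)

  pairWins⇒seekerWinsFor : (∀ x y → PairWin x y) → ∀ n → SeekerWinsFor R n
  pairWins⇒seekerWinsFor win n = forces⇒seekerWinsFrom (forces-map allSettled⇒atMostOneValid
    (forces-all settled-persistent (forces-settled win) (cartesianProduct (allFin n) (allFin n)) _))

r₂-∷ʳ⁻ : ∀ {s t p} c → r₂ s t (p ++ [ c ]) → r₂ s t p
r₂-∷ʳ⁻ c (s∉ , t∉) = (λ s⊑p → s∉ (⊑-∷ʳ c s⊑p)) , (λ t⊑p → t∉ (⊑-∷ʳ c t⊑p))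

alternating : ℕ → List Bool
alternating j = concat (replicate j (true ∷ false ∷ []))

-- The paper's 1^a w 1^c with w = (01)^j 0 is written here as 1^a 0 (10)^j 1^c.
data R♯Form : List Bool → Set where
  ones   : ∀ m → R♯Form (replicate m true)
  padded : ∀ a j c → R♯Form (replicate a true ++ false ∷ alternating j ++ replicate c true)

R♯-∷⁻ : ∀ {b s} → R♯ (b ∷ s) → R♯ s
R♯-∷⁻ r♯ k k-bad w⊑s = r♯ k k-bad (⊑-∷ _ w⊑s)

R♯-after-011 : ∀ k r → R♯ (run (suc (suc k)) ++ r) → ∃ λ c → r ≡ replicate c true
R♯-after-011 k []          r♯ = 0 , refl
R♯-after-011 k (false ∷ r) r♯ =
  ⊥-elim (r♯ (suc (suc k)) (inj₂ (s≤s (s≤s z≤n)))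
                ([] , r , sym (++-assoc (run (suc (suc k))) [ false ] r)))
R♯-after-011 k (true ∷ r)  r♯
  with c , refl ← R♯-after-011 (suc k) r
                    (subst R♯ (cong (false ∷_) (replicate-++-∷ (suc (suc k)) true r)) r♯)
  = suc c , refl

R♯-after-0 : ∀ s → R♯ (false ∷ s) → ∃₂ λ j c → s ≡ alternating j ++ replicate c true
R♯-after-0 []                 r♯ = 0 , 0 , refl
R♯-after-0 (false ∷ s)        r♯ = ⊥-elim (r♯ 0 (inj₁ refl) ([] , s , refl))
R♯-after-0 (true ∷ [])        r♯ = 0 , 1 , refl
R♯-after-0 (true ∷ false ∷ s) r♯ with j , c , refl ← R♯-after-0 s (R♯-∷⁻ (R♯-∷⁻ r♯)) = suc j , c , refl
R♯-after-0 (true ∷ true ∷ s)  r♯ with c , refl ← R♯-after-011 0 s r♯ = 0 , suc (suc c) , refl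

R♯⇒R♯Form : ∀ {s} → R♯ s → R♯Form s
R♯⇒R♯Form {[]} r♯ = ones 0
R♯⇒R♯Form {true ∷ s} r♯ with R♯⇒R♯Form (R♯-∷⁻ r♯)
... | ones m       = ones (suc m)
... | padded a j c = padded (suc a) j c
R♯⇒R♯Form {false ∷ s} r♯ with j , c , refl ← R♯-after-0 s r♯ = padded 0 j c

module SeekerStrategy (s₂ : List Bool) where

  open PairwiseElimination (r₂ s001 s₂) r₂-∷ʳ⁻ public

  Lacks : List Bool → List Bool → Set
  Lacks x w = ∃ λ v → x EndsWith v × v ++ w ≡ s₂

  lacks-start : ∀ x → Lacks x s₂
  lacks-start x = [] , endsWith-[] x , refl

  lacks-∷ʳ : ∀ {x b w} → Lacks x (b ∷ w) → Lacks (x ++ [ b ]) w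
  lacks-∷ʳ {b = b} {w} (v , x-v , v-bw) = v ++ [ b ] , endsWith-∷ʳ b x-v , trans (++-assoc v [ b ] w) v-bw

  lacks-[] : ∀ {x} → Lacks x [] → ¬ r₂ s001 s₂ x
  lacks-[] {x} (v , x-v , v≡s₂) (_ , s₂∉x) =
    s₂∉x (endsWith⇒⊑ (subst (x EndsWith_) (trans (sym (++-identityʳ v)) v≡s₂) x-v))

  ends00-∷ʳ-true : ∀ {x} → x EndsWith (false ∷ false ∷ []) → ¬ r₂ s001 s₂ (x ++ [ true ])
  ends00-∷ʳ-true x-00 (001∉x , _) = 001∉x (endsWith⇒⊑ (endsWith-∷ʳ true x-00))

  ends00-∷ʳ-false : ∀ {x} → x EndsWith (false ∷ false ∷ []) → (x ++ [ false ]) EndsWith (false ∷ false ∷ [])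
  ends00-∷ʳ-false x-00 = endsWith-++⁻ [ false ] (endsWith-∷ʳ false x-00)

  trapped : ∀ w {x y} → x EndsWith (false ∷ false ∷ []) → Lacks y w → PairWin x y
  trapped []          x-00 y-w = won (inj₂ (lacks-[] y-w))
  trapped (false ∷ w) x-00 y-w = askSame λ
    { true  → won (inj₁ (ends00-∷ʳ-true x-00))
    ; false → trapped w (ends00-∷ʳ-false x-00) (lacks-∷ʳ y-w) }
  trapped (true ∷ w)  x-00 y-w = askSplit λ
    { true  → won (inj₁ (ends00-∷ʳ-true x-00))
    ; false → trapped w (ends00-∷ʳ-false x-00) (lacks-∷ʳ y-w) }

  bothEnd0 : ∀ x y → PairWin (x ++ [ false ]) (y ++ [ false ])
  bothEnd0 x y = askSplit λ
    { false → trapped s₂ (endsWith-∷ʳ false (x , refl)) (lacks-start _)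
    ; true  → pairWin-sym (trapped s₂ (endsWith-∷ʳ false (y , refl)) (lacks-start _)) }

  finishOnes : ∀ c {x y} → Lacks x (replicate c true) → PairWin x y
  finishOnes zero          x-w = won (inj₁ (lacks-[] x-w))
  finishOnes (suc c) {x} {y} x-w = askSame λ
    { true  → finishOnes c (lacks-∷ʳ x-w)
    ; false → bothEnd0 x y }

  finishAlternating : ∀ j c {x y} → x EndsWith [ false ] →
                      Lacks x (alternating j ++ replicate c true) → PairWin x y
  finishAlternating zero    c x-0 x-w = finishOnes c x-w
  finishAlternating (suc j) c {x} {y} x-0 x-w = askSplit λ
    { false → trapped s₂ (endsWith-∷ʳ false x-0) (lacks-start _)
    ; true  → askSplit λ
        { true  → pairWin-sym (trapped s₂ (endsWith-∷ʳ false (y , refl)) (lacks-start _))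
        ; false → finishAlternating j c (x ++ [ true ] , refl) (lacks-∷ʳ (lacks-∷ʳ x-w)) } }

  finishPadded : ∀ a j c {x y} → Lacks x (replicate a true ++ false ∷ alternating j ++ replicate c true) →
                 Lacks y (replicate a true ++ false ∷ alternating j ++ replicate c true) → PairWin x y
  finishPadded zero    j c {x} {y} x-w y-w = askSplit λ
    { false → finishAlternating j c (x , refl) (lacks-∷ʳ x-w)
    ; true  → pairWin-sym (finishAlternating j c (y , refl) (lacks-∷ʳ y-w)) }
  finishPadded (suc a) j c {x} {y} x-w y-w = askSame λ
    { true  → finishPadded a j c (lacks-∷ʳ x-w) (lacks-∷ʳ y-w)
    ; false → bothEnd0 x y }

R♯Form⇒seekerWins : ∀ {s₂} → R♯Form s₂ → SeekerWins (r₂ s001 s₂)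
R♯Form⇒seekerWins (ones m) n _ = pairWins⇒seekerWinsFor (λ x _ → finishOnes m (lacks-start x)) n
  where open SeekerStrategy (replicate m true)
R♯Form⇒seekerWins (padded a j c) n _ =
  pairWins⇒seekerWinsFor (λ x y → finishPadded a j c (lacks-start x) (lacks-start y)) n
  where open SeekerStrategy (replicate a true ++ false ∷ alternating j ++ replicate c true)

module Obscurer (k : ℕ) (k≢1 : k ≢ 1) where

  Blocked : ℕ → Set
  Blocked i = i ≡ 0 ⊎ i ≡ k

  blocked? : ∀ i → Dec (Blocked i)
  blocked? i = (i ≟ 0) ⊎-dec (i ≟ k)

  blocked⇒suc≢k : ∀ {i} → Blocked i → suc i ≢ k
  blocked⇒suc≢k (inj₁ refl) 1≡k = k≢1 (sym 1≡k)
  blocked⇒suc≢k (inj₂ refl) = 1+n≢n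

  Safe : List Bool → Set
  Safe p = ∀ {i} → Blocked i → ¬ (run i ++ [ false ]) ⊑ p

  data Tail : Set where
    allOnes : Tail
    lastRun : ℕ → Tail

  Ends : List Bool → Tail → Set
  Ends p allOnes     = ∃ λ m → p ≡ replicate m true
  Ends p (lastRun i) = p EndsWith run i

  next : Tail → Tail
  next allOnes     = allOnes
  next (lastRun i) = lastRun (suc i)

  Extendable : Tail → Set
  Extendable allOnes     = ⊤
  Extendable (lastRun i) = ¬ Blocked i

  ends-∷ʳ-true : ∀ {p} t → Ends p t → Ends (p ++ [ true ]) (next t)
  ends-∷ʳ-true allOnes     (m , refl) = suc m , sym (replicate-∷ʳ m true)
  ends-∷ʳ-true (lastRun i) p-i        = endsWith-run-∷ʳ i p-i

  extendable⇒¬endsWith : ∀ {p i} t → Ends p t → Extendable t → Blocked i → ¬ p EndsWith run i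
  extendable⇒¬endsWith allOnes     (m , refl) _         _  = ones-∌-run m
  extendable⇒¬endsWith (lastRun j) p-j        ¬blocked blocked p-i
    with refl ← endsWith-run-unique j _ p-j p-i = ¬blocked blocked

  safe-∷ʳ-true : ∀ {p} → Safe p → Safe (p ++ [ true ])
  safe-∷ʳ-true {p} safe {i} blocked w⊑p1 with ⊑-∷ʳ⁻ p true w⊑p1
  ... | inj₁ w⊑p = safe blocked w⊑p
  ... | inj₂ p1-w with () ← proj₁ (endsWith-∷ʳ⁻ {v = run i} p1-w)

  safe-∷ʳ-false : ∀ {p} t → Safe p → Ends p t → Extendable t → Safe (p ++ [ false ])
  safe-∷ʳ-false {p} t safe ends ext {i} blocked w⊑p0 with ⊑-∷ʳ⁻ p false w⊑p0
  ... | inj₁ w⊑p  = safe blocked w⊑p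
  ... | inj₂ p0-w = extendable⇒¬endsWith t ends ext blocked (proj₂ (endsWith-∷ʳ⁻ {v = run i} p0-w))

  Compatible : Tail → Tail → Set
  Compatible (lastRun i) (lastRun j) = i ≢ j × ¬ (Blocked i × Blocked j)
  Compatible allOnes     _           = ⊤
  Compatible (lastRun i) allOnes     = ⊤

  compatible-sym : ∀ t u → Compatible t u → Compatible u t
  compatible-sym allOnes     allOnes     _             = tt
  compatible-sym allOnes     (lastRun j) _             = tt
  compatible-sym (lastRun i) allOnes     _             = tt
  compatible-sym (lastRun i) (lastRun j) (i≢j , ¬both) =
    (λ j≡i → i≢j (sym j≡i)) , λ (bj , bi) → ¬both (bi , bj)

  compatible-next : ∀ t u → Compatible t u → Compatible (next t) (next u)
  compatible-next allOnes     _           _             = tt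
  compatible-next (lastRun i) allOnes     _             = tt
  compatible-next (lastRun i) (lastRun j) (i≢j , _) =
    (λ si≡sj → i≢j (suc-injective si≡sj)) , λ where
      (inj₂ si≡k , inj₂ sj≡k) → i≢j (suc-injective (trans si≡k (sym sj≡k)))

  compatible-fresh : ∀ {j} → suc j ≢ k → Compatible (lastRun 0) (lastRun (suc j))
  compatible-fresh sj≢k = (λ ()) , λ where
    (_ , inj₂ sj≡k) → sj≢k sj≡k

  choose : ∀ t u → Compatible t u →
           (Extendable t × Compatible (lastRun 0) (next u)) ⊎
           (Extendable u × Compatible (next t) (lastRun 0))
  choose allOnes     allOnes     _ = inj₁ (tt , tt)
  choose allOnes     (lastRun j) _ with suc j ≟ k
  ... | no  sj≢k = inj₁ (tt , compatible-fresh sj≢k)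
  ... | yes sj≡k = inj₂ ((λ bj → blocked⇒suc≢k bj sj≡k) , tt)
  choose (lastRun i) allOnes     _ with suc i ≟ k
  ... | no  si≢k = inj₂ (tt , compatible-sym (lastRun 0) _ (compatible-fresh si≢k))
  ... | yes si≡k = inj₁ ((λ bi → blocked⇒suc≢k bi si≡k) , tt)
  choose (lastRun i) (lastRun j) (i≢j , ¬both) with blocked? i | suc j ≟ k
  ... | no ¬bi | no sj≢k  = inj₁ (¬bi , compatible-fresh sj≢k)
  ... | yes bi | _        = inj₂ ((λ bj → ¬both (bi , bj)) ,
                                  compatible-sym (lastRun 0) _ (compatible-fresh (blocked⇒suc≢k bi)))
  ... | no _   | yes sj≡k = inj₂ ((λ bj → blocked⇒suc≢k bj sj≡k) ,
                                  compatible-sym (lastRun 0) _ (compatible-fresh λ si≡k →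
                                    i≢j (suc-injective (trans si≡k (sym sj≡k)))))

  data Evading (p q : List Bool) : Set where
    evading : ∀ {t u} → Safe p → Safe q → Ends p t → Ends q u → Compatible t u → Evading p q

  evading-[] : Evading [] []
  evading-[] = evading {t = allOnes} {allOnes} (λ _ → ¬∷⊑[]) (λ _ → ¬∷⊑[]) (0 , refl) (0 , refl) tt

  evading-agree : ∀ {p q} → Evading p q → Evading (p ++ [ true ]) (q ++ [ true ])
  evading-agree (evading {t} {u} safe₁ safe₂ ends₁ ends₂ compat) =
    evading (safe-∷ʳ-true safe₁) (safe-∷ʳ-true safe₂) (ends-∷ʳ-true t ends₁) (ends-∷ʳ-true u ends₂)
            (compatible-next t u compat)

  evading-split : ∀ {p q} → Evading p q →
                  Evading (p ++ [ false ]) (q ++ [ true ]) ⊎ Evading (p ++ [ true ]) (q ++ [ false ])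
  evading-split {p} {q} (evading {t} {u} safe₁ safe₂ ends₁ ends₂ compat) with choose t u compat
  ... | inj₁ (ext , compat′) = inj₁ (evading (safe-∷ʳ-false t safe₁ ends₁ ext) (safe-∷ʳ-true safe₂)
                                             (p , refl) (ends-∷ʳ-true u ends₂) compat′)
  ... | inj₂ (ext , compat′) = inj₂ (evading (safe-∷ʳ-true safe₁) (safe-∷ʳ-false u safe₂ ends₂ ext)
                                             (ends-∷ʳ-true t ends₁) (q , refl) compat′)

  respond : ∀ {p q} a b → Evading p q →
            Σ Bool λ ans → Evading (p ++ [ ans xor a ]) (q ++ [ ans xor b ])
  respond true  true  ev = false , evading-agree ev
  respond false false ev = true  , evading-agree ev
  respond false true  ev with evading-split ev
  ... | inj₁ ev′ = false , ev′
  ... | inj₂ ev′ = true  , ev′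
  respond true  false ev with evading-split ev
  ... | inj₁ ev′ = true  , ev′
  ... | inj₂ ev′ = false , ev′

  evade : ∀ {R : LieRestriction} → (∀ {p} → Safe p → R p) →
          (st : State 2) → Evading (st Fin.zero) (st (Fin.suc Fin.zero)) → ¬ SeekerWinsFrom R st
  evade safe⇒R st (evading safe₁ safe₂ _ _ _) (done atMostOne)
    with () ← atMostOne _ _ (safe⇒R safe₁) (safe⇒R safe₂)
  evade safe⇒R st ev (ask Q next-win) with ans , ev′ ← respond (Q Fin.zero) (Q (Fin.suc Fin.zero)) ev =
    evade safe⇒R (update st Q ans) ev′ (next-win ans)

0⊎≥2⇒≢1 : ∀ {k} → k ≡ 0 ⊎ 2 ≤ k → k ≢ 1
0⊎≥2⇒≢1 (inj₁ refl) ()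
0⊎≥2⇒≢1 (inj₂ (s≤s ())) refl

seekerLosesFor2 : ∀ {k s₂} → k ≡ 0 ⊎ 2 ≤ k → (run k ++ [ false ]) ⊑ s₂ →
                  ¬ SeekerWinsFor (r₂ s001 s₂) 2
seekerLosesFor2 {k} {s₂} k-bad 01ᵏ0⊑s₂ = evade safe⇒r₂ (λ _ → []) evading-[]
  where
  open Obscurer k (0⊎≥2⇒≢1 k-bad)
  safe⇒r₂ : ∀ {p} → Safe p → r₂ s001 s₂ p
  safe⇒r₂ safe = (λ 001⊑p → safe (inj₁ refl) (⊑-trans ([] , [ true ] , refl) 001⊑p))
               , (λ s₂⊑p → safe (inj₂ refl) (⊑-trans 01ᵏ0⊑s₂ s₂⊑p))

lemma10 : (s₂ : List Bool) → 3 ≤ length s₂ → s₂ ≢ s001 →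
          (SeekerWins (r₂ s001 s₂) ⇔ R♯ s₂)
lemma10 s₂ _ _ = mk⇔
  (λ wins k k-bad 01ᵏ0⊑s₂ → seekerLosesFor2 k-bad 01ᵏ0⊑s₂ (wins 2 (s≤s z≤n)))
  (λ r♯ → R♯Form⇒seekerWins (R♯⇒R♯Form r♯))
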